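{- Let $\Phi$ be a c-map (as in the context) on $D=K^s$, let $\bar\alpha=(\alpha_1,\dots,\alpha_s)^T\in D$ and $(\beta_1,\dots,\beta_s)^T=A_{\bar\alpha}F_{\bar\alpha}(\bar\alpha)+\gamma(\bar\alpha)$. If $1,\alpha_1,\dots,\alpha_s$ are linearly independent over $\mathbb{Q}$, then $1,\beta_1,\dots,\beta_s$ are linearly independent over $\mathbb{Q}$.
   Context: Let $p$ be a prime; $\mathrm{ord}_p$ is the $p$-adic valuation ($\mathrm{ord}_p(0)=\infty$), $U_p=\mathbb{Z}_p\setminus p\mathbb{Z}_p$. Let $K\subset\mathbb{Q}_p$ be a finite extension of $\mathbb{Q}$ of degree $d$, $s=d-1$ if $d\ge2$ and $s=1$ if $d=1$, $D=K^s$. A c-map $\Phi$ assigns to each $\bar\alpha=(\alpha_1,\dots,\alpha_s)^T\in D$ a quadruple $(\phi(\bar\alpha),F_{\bar\alpha},A_{\bar\alpha},\gamma(\bar\alpha))$ with $\phi(\bar\alpha)\in\{1,\dots,s\}$, $A_{\bar\alpha}$ an invertible $s\times s$ matrix whose entries and whose inverse's entries lie in $\mathbb{Z}_p\cap\mathbb{Q}$, $\gamma(\bar\alpha)\in(p\mathbb{Z}_p\cap\mathbb{Q})^s$ with $\gamma(\bar0)=\bar0$, and $F_{\bar\alpha}=(f_1,\dots,f_s)^T$ given as follows, with $j=\phi(\bar\alpha)$. If $\alpha_j\ne0$, $F_{\bar\alpha}$ is defined on $\{\bar x\in D:x_j\ne0\}$ by $f_j(\bar x)=\frac{u_jp^{\mathrm{ord}_p(\alpha_j)}}{x_j}-v_j$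 and $f_i(\bar x)=\frac{u'_ip^{k_i}x_i}{x_j}-v'_i$ for $i\ne j$, where $u_j,v_j,u'_i\in U_p\cap\mathbb{Q}$, $v'_i\in\mathbb{Z}_p\cap\mathbb{Q}$ (depending on $\bar\alpha$), $k_i=\max\{\mathrm{ord}_p(\alpha_j)-\mathrm{ord}_p(\alpha_i),0\}$, and these constants are such that $f_i(\bar\alpha)\in p\mathbb{Z}_p$ for all $i$. If $\alpha_j=0$, $F_{\bar\alpha}$ is the identity of $D$. -}

module Defs where

open import Level using (0ℓ)
open import Data.Nat as ℕ using (ℕ; zero; suc; NonZero)
open import Data.Nat.Divisibility using (_∣_)
open import Data.Nat.Primality using (Prime; prime⇒nonZero)
open import Data.Nat.Properties using (m^n≢0)
open import Data.Integer as ℤ using (ℤ; +_; -[1+_])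
open import Data.Rational as ℚ using (ℚ; ↥_; ↧ₙ_)
open import Data.Fin as Fin using (Fin)
open import Data.Product using (_×_; ∃)
open import Data.Unit using (⊤)
open import Data.Empty using (⊥)
open import Relation.Nullary using (¬_; yes; no)
open import Relation.Binary.PropositionalEquality using (_≡_; _≢_)
open import Algebra.Structures using (IsCommutativeRing)

-- q ∈ ℤ_p ∩ ℚ : p does not divide the (reduced) denominator
InZp : ℕ → ℚ → Set
InZp p q = ¬ (p ∣ ↧ₙ q)

InpZp : ℕ → ℚ → Set
InpZp p q = ¬ (p ∣ ↧ₙ q) × p ∣ ℤ.∣ ↥ q ∣

InUp : ℕ → ℚ → Set
InUp p q = ¬ (p ∣ ↧ₙ q) × ¬ (p ∣ ℤ.∣ ↥ q ∣)

ℕtoℚ : ℕ → ℚ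
ℕtoℚ n = (+ n) ℚ./ 1

powℚ : (p : ℕ) → Prime p → ℤ → ℚ
powℚ p pr (+ n)     = (+ (p ℕ.^ n)) ℚ./ 1
powℚ p pr -[1+ n ]  = ℚ._/_ (+ 1) (p ℕ.^ suc n) {{m^n≢0 p (suc n) {{prime⇒nonZero pr}}}}

-- ℤ ∪ {∞} (values of ord_p; ord_p 0 = ∞)

data ℤ∞ : Set where
  fin : ℤ → ℤ∞
  ∞   : ℤ∞

_≤∞_ : ℤ∞ → ℤ∞ → Set
fin a ≤∞ fin b = a ℤ.≤ b
fin a ≤∞ ∞     = ⊤
∞     ≤∞ fin b = ⊥
∞     ≤∞ ∞     = ⊤

_+∞_ : ℤ∞ → ℤ∞ → ℤ∞
fin a +∞ fin b = fin (a ℤ.+ b)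
fin a +∞ ∞     = ∞
∞     +∞ _     = ∞

min∞ : ℤ∞ → ℤ∞ → ℤ∞
min∞ (fin a) (fin b) = fin (a ℤ.⊓ b)
min∞ (fin a) ∞       = fin a
min∞ ∞       y       = y

sumFin : {A : Set} → A → (A → A → A) → (n : ℕ) → (Fin n → A) → A
sumFin z _⊕_ zero    f = z
sumFin z _⊕_ (suc n) f = f Fin.zero ⊕ sumFin z _⊕_ n (λ i → f (Fin.suc i))

-- A number field K of degree d over ℚ together with an embedding
-- K ⊂ ℚ_p, presented by the restriction of ord_p to K:
-- a discrete valuation on K extending ord_p on ℚ, with value group ℤ
-- (ramification index 1) and residue field 𝔽_p (residue degree 1).

record NumberFieldInQp (p : ℕ) (d : ℕ) : Set₁ where
  field
    K     : Set
    0K 1K : K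
    _+K_  : K → K → K
    _*K_  : K → K → K
    -K_   : K → K
    invK  : K → K
    isCommutativeRing : IsCommutativeRing _≡_ _+K_ _*K_ -K_ 0K 1K
    0≢1   : 0K ≢ 1K
    invK-r : ∀ x → x ≢ 0K → x *K invK x ≡ 1K
    ι     : ℚ → K
    ι-+   : ∀ a b → ι (a ℚ.+ b) ≡ ι a +K ι b
    ι-*   : ∀ a b → ι (a ℚ.* b) ≡ ι a *K ι b
    ι-1   : ι ℚ.1ℚ ≡ 1K
    -- [K : ℚ] = d : a ℚ-basis of K of size d
    basis  : Fin d → K
    spans  : ∀ x → ∃ λ (c : Fin d → ℚ) →
               x ≡ sumFin 0K _+K_ d (λ i → ι (c i) *K basis i)
    indep  : ∀ (c : Fin d → ℚ) →
               sumFin 0K _+K_ d (λ i → ι (c i) *K basis i) ≡ 0K →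
               ∀ i → c i ≡ ℚ.0ℚ
    ord      : K → ℤ∞
    ord-∞⇒0  : ∀ x → ord x ≡ ∞ → x ≡ 0K
    ord-0    : ord 0K ≡ ∞
    ord-*    : ∀ x y → ord (x *K y) ≡ ord x +∞ ord y
    ord-+    : ∀ x y → min∞ (ord x) (ord y) ≤∞ ord (x +K y)
    ord-p    : ord (ι (ℕtoℚ p)) ≡ fin (+ 1)
    ord-unit : ∀ q → InUp p q → ord (ι q) ≡ fin (+ 0)
    residue  : ∀ x → fin (+ 0) ≤∞ ord x →
               ∃ λ (n : ℕ) → fin (+ 1) ≤∞ ord (x +K (-K ι (ℕtoℚ n)))

sOf : ℕ → ℕ
sOf zero          = 1
sOf (suc zero)    = 1
sOf (suc (suc n)) = suc n

module _ {p d : ℕ} (pr : Prime p) (𝕂 : NumberFieldInQp p d) where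
  open NumberFieldInQp 𝕂

  private
    s = sOf d

  D : Set
  D = Fin s → K

  0D : D
  0D _ = 0K

  ΣK : (Fin s → K) → K
  ΣK = sumFin 0K _+K_ s

  Σℚ : (Fin s → ℚ) → ℚ
  Σℚ = sumFin ℚ.0ℚ ℚ._+_ s

  InpZpK : K → Set
  InpZpK x = fin (+ 1) ≤∞ ord x

  LinIndep1 : D → Set
  LinIndep1 α = ∀ (c₀ : ℚ) (c : Fin s → ℚ) →
    ι c₀ +K ΣK (λ i → ι (c i) *K α i) ≡ 0K →
    (c₀ ≡ ℚ.0ℚ) × (∀ i → c i ≡ ℚ.0ℚ)

  kExp : ℤ → ℤ∞ → ℤ
  kExp n (fin m) = (n ℤ.- m) ℤ.⊔ + 0
  kExp n ∞       = + 0

  -- the map F_ᾱ in the case α_j ≠ 0, with ord α_j = n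
  mobius : (α : D) (j : Fin s) (n : ℤ) (u v : Fin s → ℚ) → D → D
  mobius α j n u v x i with i Fin.≟ j
  ... | yes _ = (ι (u j ℚ.* powℚ p pr n) *K invK (x j)) +K (-K ι (v j))
  ... | no  _ = ((ι (u i ℚ.* powℚ p pr (kExp n (ord (α i)))) *K x i) *K invK (x j))
                  +K (-K ι (v i))

  -- the component F_ᾱ of a c-map at ᾱ, with j = φ(ᾱ)
  data FMap (α : D) (j : Fin s) : (D → D) → Set where
    idF  : α j ≡ 0K → FMap α j (λ x → x)
    mobF : α j ≢ 0K → (n : ℤ) → ord (α j) ≡ fin n →
           (u v : Fin s → ℚ) →
           (∀ i → InUp p (u i)) → InUp p (v j) → (∀ i → InZp p (v i)) →
           (∀ i → InpZpK (mobius α j n u v α i)) →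
           FMap α j (mobius α j n u v)

  idMat : Fin s → Fin s → ℚ
  idMat i k with i Fin.≟ k
  ... | yes _ = ℚ.1ℚ
  ... | no  _ = ℚ.0ℚ

  record CMapAt (α : D) : Set where
    field
      φ     : Fin s
      F     : D → D
      F-ok  : FMap α φ F
      A     : Fin s → Fin s → ℚ
      Ainv  : Fin s → Fin s → ℚ
      A-Zp    : ∀ i k → InZp p (A i k)
      Ainv-Zp : ∀ i k → InZp p (Ainv i k)
      A-Ainv  : ∀ i k → Σℚ (λ l → A i l ℚ.* Ainv l k)
                        ≡ (idMat i k)
      Ainv-A  : ∀ i k → Σℚ (λ l → Ainv i l ℚ.* A l k)
                        ≡ (idMat i k)
      γ     : Fin s → ℚ
      γ-pZp : ∀ i → InpZp p (γ i)

  record CMap : Set where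
    field
      Φ    : (α : D) → CMapAt α
      γ-0  : ∀ i → CMapAt.γ (Φ 0D) i ≡ ℚ.0ℚ

  image : CMap → D → D
  image Ψ α i = ΣK (λ k → ι (A i k) *K F α k) +K ι (γ i)
    where open CMapAt (CMap.Φ Ψ α)

module Submission where

-- The step is a composite of three kinds of maps, and each of them
-- transforms a ℚ-relation among 1 and the new coordinates into a
-- ℚ-relation among 1 and the old ones, which must then be trivial:
--   * the projective map  x ↦ (a/x_j at j, b_i x_i/x_j at i ≠ j)  with
--     a, b_i ≠ 0: clearing the denominator x_j turns a relation
--     e₀ + Σ d_k y_k = 0 into  d_j a + Σ_k c_k x_k = 0  with c_j = e₀ and
--     c_k = d_k b_k for k ≠ j  (projective-independent);
--   * a linear map  x ↦ A x  with A right-invertible over ℚ: the relation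
--     with coefficient row c becomes one with row c A  (linear-independent);
--   * a translation  x ↦ x + t  by a rational vector  (translate-independent).
-- F_ᾱ is either the identity or (projective map) followed by the translation
-- by −v (FMap-independent), and β̄ is F_ᾱ(ᾱ) followed by A_ᾱ and the
-- translation by γ(ᾱ).

open import Defs
open import Data.Nat using (ℕ)
open import Data.Nat.Primality using (Prime)

open import Level using (0ℓ)
open import Data.Nat as ℕ using (zero; suc)
open import Data.Nat.Divisibility using (_∣0)
open import Data.Nat.Primality using (prime⇒nonZero)
open import Data.Nat.Properties using (m^n≢0)
open import Data.Integer as ℤ using (-[1+_])
open import Data.Rational as ℚ using (ℚ; 0ℚ; 1ℚ)
import Data.Rational.Properties as ℚP
open import Data.Fin as Fin using (Fin)
open import Data.Fin.Properties using (suc-injective)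
open import Function using (_∘′_)
open import Data.Vec.Functional using (Vector; foldr; updateAt)
open import Data.Vec.Functional.Properties using (updateAt-updates; updateAt-minimal)
open import Data.Product using (_×_; _,_; proj₁; proj₂)
open import Relation.Nullary using (yes; no; contradiction)
open import Relation.Binary.PropositionalEquality using (_≡_; _≢_)
open import Algebra.Bundles using (CommutativeMonoid; Semiring; CommutativeRing)

module CommutativeMonoidSums {c ℓ} (M : CommutativeMonoid c ℓ) where
  open CommutativeMonoid M renaming (_∙_ to _+_; ε to 0#)
  open import Algebra.Properties.CommutativeMonoid.Sum M using (sum; sum-cong-≋; sum-replicate-zero)
  open import Algebra.Properties.CommutativeSemigroup commutativeSemigroup using (x∙yz≈y∙xz)
  open import Relation.Binary.Reasoning.Setoid setoid

  sum-exchange : ∀ {n} (f g : Vector Carrier n) (j : Fin n) →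
                 (∀ k → k ≢ j → f k ≈ g k) → f j + sum g ≈ g j + sum f
  sum-exchange {suc n} f g Fin.zero agree = begin
    f Fin.zero + (g Fin.zero + sum (g ∘′ Fin.suc))
      ≈⟨ ∙-congˡ (∙-congˡ (sum-cong-≋ (λ k → sym (agree (Fin.suc k) λ ())))) ⟩
    f Fin.zero + (g Fin.zero + sum (f ∘′ Fin.suc))
      ≈⟨ x∙yz≈y∙xz _ _ _ ⟩
    g Fin.zero + (f Fin.zero + sum (f ∘′ Fin.suc)) ∎
  sum-exchange {suc n} f g (Fin.suc j) agree = begin
    f (Fin.suc j) + (g Fin.zero + sum (g ∘′ Fin.suc))
      ≈⟨ x∙yz≈y∙xz _ _ _ ⟩
    g Fin.zero + (f (Fin.suc j) + sum (g ∘′ Fin.suc))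
      ≈⟨ ∙-congˡ (sum-exchange (f ∘′ Fin.suc) (g ∘′ Fin.suc) j
                   (λ k k≢j → agree (Fin.suc k) (λ e → k≢j (suc-injective e)))) ⟩
    g Fin.zero + (g (Fin.suc j) + sum (f ∘′ Fin.suc))
      ≈⟨ ∙-congʳ (sym (agree Fin.zero λ ())) ⟩
    f Fin.zero + (g (Fin.suc j) + sum (f ∘′ Fin.suc))
      ≈⟨ x∙yz≈y∙xz _ _ _ ⟩
    g (Fin.suc j) + (f Fin.zero + sum (f ∘′ Fin.suc)) ∎

  sum-single : ∀ {n} (f : Vector Carrier n) (j : Fin n) →
               (∀ k → k ≢ j → f k ≈ 0#) → sum f ≈ f j
  sum-single {n} f j vanish = begin
    sum f                     ≈⟨ sym (identityˡ _) ⟩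
    0# + sum f                ≈⟨ sym (sum-exchange f (λ _ → 0#) j vanish) ⟩
    f j + sum {n} (λ _ → 0#)  ≈⟨ ∙-congˡ (sum-replicate-zero n) ⟩
    f j + 0#                  ≈⟨ identityʳ _ ⟩
    f j                       ∎

module SemiringSums {c ℓ} (R : Semiring c ℓ) where
  open Semiring R
  open import Algebra.Properties.Semiring.Sum R using (sum; sum-cong-≋; ∑-comm; *-distribˡ-sum; *-distribʳ-sum)
  open import Relation.Binary.Reasoning.Setoid setoid

  sum-reassoc : ∀ {n m} (c : Vector Carrier n) (A : Fin n → Fin m → Carrier)
                (y : Vector Carrier m) →
                sum (λ i → c i * sum (λ l → A i l * y l))
                  ≈ sum (λ l → sum (λ i → c i * A i l) * y l)
  sum-reassoc c A y = begin
    sum (λ i → c i * sum (λ l → A i l * y l))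
      ≈⟨ sum-cong-≋ (λ i → *-distribˡ-sum (c i) (λ l → A i l * y l)) ⟩
    sum (λ i → sum (λ l → c i * (A i l * y l)))
      ≈⟨ ∑-comm (λ i l → c i * (A i l * y l)) ⟩
    sum (λ l → sum (λ i → c i * (A i l * y l)))
      ≈⟨ sum-cong-≋ (λ l → sum-cong-≋ (λ i → sym (*-assoc (c i) (A i l) (y l)))) ⟩
    sum (λ l → sum (λ i → (c i * A i l) * y l))
      ≈⟨ sum-cong-≋ (λ l → sym (*-distribʳ-sum (y l) (λ i → c i * A i l))) ⟩
    sum (λ l → sum (λ i → c i * A i l) * y l) ∎

open import Relation.Binary.PropositionalEquality using (refl; sym; trans; cong; cong₂; module ≡-Reasoning)

sumFin≡foldr : ∀ {A : Set} (z : A) (_⊕_ : A → A → A) n (f : Fin n → A) →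
               sumFin z _⊕_ n f ≡ foldr _⊕_ z f
sumFin≡foldr z _⊕_ zero    f = refl
sumFin≡foldr z _⊕_ (suc n) f =
  cong (f Fin.zero ⊕_) (sumFin≡foldr z _⊕_ n (λ i → f (Fin.suc i)))

*-cancelʳ-≢0 : ∀ x y → x ℚ.* y ≡ 0ℚ → y ≢ 0ℚ → x ≡ 0ℚ
*-cancelʳ-≢0 x y xy≡0 y≢0 = begin
  x                        ≡⟨ sym (ℚP.*-identityʳ x) ⟩
  x ℚ.* 1ℚ                 ≡⟨ cong (x ℚ.*_) (sym (ℚP.*-inverseʳ y)) ⟩
  x ℚ.* (y ℚ.* ℚ.1/ y)     ≡⟨ sym (ℚP.*-assoc x y (ℚ.1/ y)) ⟩
  (x ℚ.* y) ℚ.* ℚ.1/ y     ≡⟨ cong (ℚ._* ℚ.1/ y) xy≡0 ⟩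
  0ℚ ℚ.* ℚ.1/ y            ≡⟨ ℚP.*-zeroˡ (ℚ.1/ y) ⟩
  0ℚ                       ∎
  where open ≡-Reasoning
        instance _ = ℚ.≢-nonZero y≢0

*-≢0 : ∀ {x y} → x ≢ 0ℚ → y ≢ 0ℚ → x ℚ.* y ≢ 0ℚ
*-≢0 {x} {y} x≢0 y≢0 xy≡0 = x≢0 (*-cancelʳ-≢0 x y xy≡0 y≢0)

nonZero⇒≢0 : ∀ q → .{{ℚ.NonZero q}} → q ≢ 0ℚ
nonZero⇒≢0 q {{nz}} refl = ℕ.≢-nonZero⁻¹ 0 {{nz}} refl

positive-fraction≢0 : ∀ m n .{{_ : ℕ.NonZero m}} .{{_ : ℕ.NonZero n}} → (ℤ.+ m) ℚ./ n ≢ 0ℚ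
positive-fraction≢0 m n =
  nonZero⇒≢0 (ℚ.normalize m n) {{ℚP.pos⇒nonZero (ℚ.normalize m n) {{ℚP.normalize-pos m n}}}}

unit≢0 : ∀ {p} q → InUp p q → q ≢ 0ℚ
unit≢0 {p} q (_ , p∤q) refl = p∤q (p ∣0)

powℚ≢0 : ∀ {p} (pr : Prime p) k → powℚ p pr k ≢ 0ℚ
powℚ≢0 {p} pr (ℤ.+ n) =
  positive-fraction≢0 (p ℕ.^ n) 1 {{m^n≢0 p n {{prime⇒nonZero pr}}}}
powℚ≢0 {p} pr -[1+ n ] =
  positive-fraction≢0 1 (p ℕ.^ suc n) {{_}} {{m^n≢0 p (suc n) {{prime⇒nonZero pr}}}}

module _ {p d : ℕ} (pr : Prime p) (𝕂 : NumberFieldInQp p d) where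

  idMat-diag : ∀ i → idMat pr 𝕂 i i ≡ 1ℚ
  idMat-diag i with i Fin.≟ i
  ... | yes _   = refl
  ... | no  i≢i = contradiction refl i≢i

  idMat-off : ∀ i k → i ≢ k → idMat pr 𝕂 i k ≡ 0ℚ
  idMat-off i k i≢k with i Fin.≟ k
  ... | yes i≡k = contradiction i≡k i≢k
  ... | no  _   = refl

module Independence {p d : ℕ} (pr : Prime p) (𝕂 : NumberFieldInQp p d) where
  open NumberFieldInQp 𝕂

  private
    s = sOf d

  Kring : CommutativeRing 0ℓ 0ℓ
  Kring = record { isCommutativeRing = isCommutativeRing }

  open CommutativeRing Kring
    using (_+_; _*_; +-commutativeMonoid; +-group; *-commutativeSemigroup; semiring;
           +-assoc; +-comm; *-assoc; *-comm; distribˡ; zeroʳ; *-identityʳ)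
  open import Algebra.Properties.Semiring.Sum semiring
    using (sum; sum-cong-≗; ∑-distrib-+; *-distribˡ-sum)
  open import Algebra.Properties.Group +-group using (identityʳ-unique; inverseʳ-unique)
  open import Algebra.Properties.CommutativeSemigroup *-commutativeSemigroup
    using (x∙yz≈y∙xz)
  open CommutativeMonoidSums +-commutativeMonoid using (sum-exchange)
  open SemiringSums semiring using (sum-reassoc)
  module ℚΣ where
    open import Algebra.Properties.Semiring.Sum (CommutativeRing.semiring ℚP.+-*-commutativeRing)
      public using (sum; sum-cong-≗; sum-replicate-zero)
    open CommutativeMonoidSums (CommutativeRing.+-commutativeMonoid ℚP.+-*-commutativeRing)
      public using (sum-single)
    open SemiringSums (CommutativeRing.semiring ℚP.+-*-commutativeRing)
      public using (sum-reassoc)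
  open ≡-Reasoning

  ΣK≡sum : ∀ f → ΣK pr 𝕂 f ≡ sum f
  ΣK≡sum = sumFin≡foldr 0K _+K_ s

  Σℚ≡sum : ∀ f → Σℚ pr 𝕂 f ≡ ℚΣ.sum f
  Σℚ≡sum = sumFin≡foldr 0ℚ ℚ._+_ s

  ι-0 : ι 0ℚ ≡ 0K
  ι-0 = identityʳ-unique (ι 0ℚ) (ι 0ℚ) (sym (trans (cong ι (sym (ℚP.+-identityʳ 0ℚ))) (ι-+ 0ℚ 0ℚ)))

  ι-neg : ∀ q → ι (ℚ.- q) ≡ -K ι q
  ι-neg q = inverseʳ-unique (ι q) (ι (ℚ.- q)) (trans (sym (ι-+ q (ℚ.- q))) (trans (cong ι (ℚP.+-inverseʳ q)) ι-0))

  ι-sum : ∀ {n} (f : Fin n → ℚ) → ι (ℚΣ.sum f) ≡ sum (λ i → ι (f i))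
  ι-sum {zero}  f = ι-0
  ι-sum {suc n} f = trans (ι-+ _ _) (cong (ι (f Fin.zero) +_) (ι-sum (λ i → f (Fin.suc i))))

  independent : ∀ {x : D pr 𝕂} → LinIndep1 pr 𝕂 x → ∀ (c₀ : ℚ) (c : Fin s → ℚ) →
                ι c₀ + sum (λ i → ι (c i) * x i) ≡ 0K →
                (c₀ ≡ 0ℚ) × (∀ i → c i ≡ 0ℚ)
  independent {x} li c₀ c rel = li c₀ c (trans (cong (ι c₀ +_) (ΣK≡sum (λ i → ι (c i) * x i))) rel)

  relation : ∀ {x : D pr 𝕂} (c₀ : ℚ) (c : Fin s → ℚ) → ι c₀ + ΣK pr 𝕂 (λ i → ι (c i) * x i) ≡ 0K →
             ι c₀ + sum (λ i → ι (c i) * x i) ≡ 0K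
  relation {x} c₀ c rel = trans (cong (ι c₀ +_) (sym (ΣK≡sum (λ i → ι (c i) * x i)))) rel

  independent-cong : ∀ {x y} → (∀ i → x i ≡ y i) → LinIndep1 pr 𝕂 x → LinIndep1 pr 𝕂 y
  independent-cong x≗y li c₀ c rel =
    independent li c₀ c (trans (cong (ι c₀ +_) (sum-cong-≗ (λ i → cong (ι (c i) *_) (x≗y i))))
                               (relation c₀ c rel))

  -- Translation by a rational vector preserves independence: a relation
  -- c₀ + Σ cᵢ(xᵢ + tᵢ) = 0 is the relation (c₀ + Σ cᵢtᵢ) + Σ cᵢxᵢ = 0.
  translate-independent : ∀ (x : D pr 𝕂) (t : Fin s → ℚ) →
                          LinIndep1 pr 𝕂 x → LinIndep1 pr 𝕂 (λ i → x i + ι (t i))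
  translate-independent x t li c₀ c rel = c₀≡0 , c≡0
    where
      shift : ℚ
      shift = ℚΣ.sum (λ i → c i ℚ.* t i)

      shifted : ι (c₀ ℚ.+ shift) + sum (λ i → ι (c i) * x i) ≡ 0K
      shifted = begin
        ι (c₀ ℚ.+ shift) + sum (λ i → ι (c i) * x i)
          ≡⟨ cong (_+ sum (λ i → ι (c i) * x i)) (ι-+ c₀ shift) ⟩
        (ι c₀ + ι shift) + sum (λ i → ι (c i) * x i)
          ≡⟨ +-assoc _ _ _ ⟩
        ι c₀ + (ι shift + sum (λ i → ι (c i) * x i))
          ≡⟨ cong (ι c₀ +_) (+-comm (ι shift) (sum (λ i → ι (c i) * x i))) ⟩
        ι c₀ + (sum (λ i → ι (c i) * x i) + ι shift)
          ≡⟨ cong (λ z → ι c₀ + (sum (λ i → ι (c i) * x i) + z))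
                  (trans (ι-sum (λ i → c i ℚ.* t i)) (sum-cong-≗ (λ i → ι-* (c i) (t i)))) ⟩
        ι c₀ + (sum (λ i → ι (c i) * x i) + sum (λ i → ι (c i) * ι (t i)))
          ≡⟨ cong (ι c₀ +_) (sym (∑-distrib-+ (λ i → ι (c i) * x i) (λ i → ι (c i) * ι (t i)))) ⟩
        ι c₀ + sum (λ i → ι (c i) * x i + ι (c i) * ι (t i))
          ≡⟨ cong (ι c₀ +_) (sum-cong-≗ (λ i → sym (distribˡ (ι (c i)) (x i) (ι (t i))))) ⟩
        ι c₀ + sum (λ i → ι (c i) * (x i + ι (t i)))
          ≡⟨ relation c₀ c rel ⟩
        0K ∎

      trivial : (c₀ ℚ.+ shift ≡ 0ℚ) × (∀ i → c i ≡ 0ℚ)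
      trivial = independent li (c₀ ℚ.+ shift) c shifted

      c≡0 : ∀ i → c i ≡ 0ℚ
      c≡0 = proj₂ trivial

      shift≡0 : shift ≡ 0ℚ
      shift≡0 = trans (ℚΣ.sum-cong-≗ (λ i → trans (cong (ℚ._* t i) (c≡0 i)) (ℚP.*-zeroˡ (t i))))
                      (ℚΣ.sum-replicate-zero s)

      c₀≡0 : c₀ ≡ 0ℚ
      c₀≡0 = begin
        c₀                ≡⟨ sym (ℚP.+-identityʳ c₀) ⟩
        c₀ ℚ.+ 0ℚ         ≡⟨ cong (c₀ ℚ.+_) (sym shift≡0) ⟩
        c₀ ℚ.+ shift      ≡⟨ proj₁ trivial ⟩
        0ℚ                ∎

  -- A linear map with a rational right-invertible matrix preserves
  -- independence: a relation with coefficient row c becomes one with row cA,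
  -- and cA = 0 forces c = (cA)B = 0.
  linear-independent : ∀ (x : D pr 𝕂) (A B : Fin s → Fin s → ℚ) →
                       (∀ i k → Σℚ pr 𝕂 (λ l → A i l ℚ.* B l k) ≡ idMat pr 𝕂 i k) →
                       LinIndep1 pr 𝕂 x →
                       LinIndep1 pr 𝕂 (λ i → ΣK pr 𝕂 (λ k → ι (A i k) * x k))
  linear-independent x A B AB≡I li c₀ c rel = proj₁ trivial , c≡0
    where
      cA : Fin s → ℚ
      cA l = ℚΣ.sum (λ i → c i ℚ.* A i l)

      pushed : ι c₀ + sum (λ l → ι (cA l) * x l) ≡ 0K
      pushed = begin
        ι c₀ + sum (λ l → ι (cA l) * x l)
          ≡⟨ cong (ι c₀ +_) (sum-cong-≗ (λ l → cong (_* x l)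
               (trans (ι-sum (λ i → c i ℚ.* A i l)) (sum-cong-≗ (λ i → ι-* (c i) (A i l)))))) ⟩
        ι c₀ + sum (λ l → sum (λ i → ι (c i) * ι (A i l)) * x l)
          ≡⟨ cong (ι c₀ +_) (sym (sum-reassoc (λ i → ι (c i)) (λ i l → ι (A i l)) x)) ⟩
        ι c₀ + sum (λ i → ι (c i) * sum (λ l → ι (A i l) * x l))
          ≡⟨ cong (ι c₀ +_) (sum-cong-≗ (λ i → cong (ι (c i) *_) (sym (ΣK≡sum (λ l → ι (A i l) * x l))))) ⟩
        ι c₀ + sum (λ i → ι (c i) * ΣK pr 𝕂 (λ l → ι (A i l) * x l))
          ≡⟨ relation c₀ c rel ⟩
        0K ∎

      trivial : (c₀ ≡ 0ℚ) × (∀ l → cA l ≡ 0ℚ)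
      trivial = independent li c₀ cA pushed

      row-times-identity : ∀ m → ℚΣ.sum (λ i → c i ℚ.* idMat pr 𝕂 i m) ≡ c m
      row-times-identity m = begin
        ℚΣ.sum (λ i → c i ℚ.* idMat pr 𝕂 i m)
          ≡⟨ ℚΣ.sum-single (λ i → c i ℚ.* idMat pr 𝕂 i m) m (λ i i≢m →
               trans (cong (c i ℚ.*_) (idMat-off pr 𝕂 i m i≢m)) (ℚP.*-zeroʳ (c i))) ⟩
        c m ℚ.* idMat pr 𝕂 m m
          ≡⟨ cong (c m ℚ.*_) (idMat-diag pr 𝕂 m) ⟩
        c m ℚ.* 1ℚ
          ≡⟨ ℚP.*-identityʳ (c m) ⟩
        c m ∎

      right-inverse : ∀ i m → ℚΣ.sum (λ l → A i l ℚ.* B l m) ≡ idMat pr 𝕂 i m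
      right-inverse i m = trans (sym (Σℚ≡sum (λ l → A i l ℚ.* B l m))) (AB≡I i m)

      c≡0 : ∀ m → c m ≡ 0ℚ
      c≡0 m = begin
        c m
          ≡⟨ sym (row-times-identity m) ⟩
        ℚΣ.sum (λ i → c i ℚ.* idMat pr 𝕂 i m)
          ≡⟨ ℚΣ.sum-cong-≗ (λ i → cong (c i ℚ.*_) (sym (right-inverse i m))) ⟩
        ℚΣ.sum (λ i → c i ℚ.* ℚΣ.sum (λ l → A i l ℚ.* B l m))
          ≡⟨ ℚΣ.sum-reassoc c A (λ l → B l m) ⟩
        ℚΣ.sum (λ l → cA l ℚ.* B l m)
          ≡⟨ ℚΣ.sum-cong-≗ (λ l → trans (cong (ℚ._* B l m) (proj₂ trivial l)) (ℚP.*-zeroˡ (B l m))) ⟩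
        ℚΣ.sum {s} (λ _ → 0ℚ)
          ≡⟨ ℚΣ.sum-replicate-zero s ⟩
        0ℚ ∎

  cancel-inverse : ∀ {y} z → y ≢ 0K → y * (z * invK y) ≡ z
  cancel-inverse {y} z y≢0 = begin
    y * (z * invK y)  ≡⟨ x∙yz≈y∙xz y z (invK y) ⟩
    z * (y * invK y)  ≡⟨ cong (z *_) (invK-r y y≢0) ⟩
    z * 1K            ≡⟨ *-identityʳ z ⟩
    z                 ∎

  projective : Fin s → ℚ → (Fin s → ℚ) → D pr 𝕂 → D pr 𝕂
  projective j a b x = updateAt (λ i → ι (b i) * x i * invK (x j)) j (λ _ → ι a * invK (x j))

  projective-pivot : ∀ j a b (x : D pr 𝕂) → x j ≢ 0K → x j * projective j a b x j ≡ ι a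
  projective-pivot j a b x xj≢0 =
    trans (cong (x j *_) (updateAt-updates j (λ i → ι (b i) * x i * invK (x j))))
          (cancel-inverse (ι a) xj≢0)

  projective-off : ∀ j a b (x : D pr 𝕂) → x j ≢ 0K →
                   ∀ k → k ≢ j → x j * projective j a b x k ≡ ι (b k) * x k
  projective-off j a b x xj≢0 k k≢j =
    trans (cong (x j *_) (updateAt-minimal k j (λ i → ι (b i) * x i * invK (x j)) k≢j))
          (cancel-inverse (ι (b k) * x k) xj≢0)

  -- The projective map with nonzero rational a, b_i preserves independence:
  -- multiplying a relation e₀ + Σ d_k y_k = 0 by α_j gives the relation
  -- d_j a + Σ_k c_k α_k = 0 with c_j = e₀ and c_k = d_k b_k for k ≠ j.
  projective-independent : ∀ (α : D pr 𝕂) j a b → α j ≢ 0K → a ≢ 0ℚ →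
                           (∀ k → k ≢ j → b k ≢ 0ℚ) →
                           LinIndep1 pr 𝕂 α → LinIndep1 pr 𝕂 (projective j a b α)
  projective-independent α j a b αj≢0 a≢0 b≢0 li e₀ d rel = e₀≡0 , d≡0
    where
      y : D pr 𝕂
      y = projective j a b α

      coeff : Fin s → ℚ
      coeff = updateAt (λ k → d k ℚ.* b k) j (λ _ → e₀)

      before after : Fin s → K
      before k = α j * (ι (d k) * y k)
      after  k = ι (coeff k) * α k

      agree : ∀ k → k ≢ j → after k ≡ before k
      agree k k≢j = begin
        ι (coeff k) * α k
          ≡⟨ cong (λ z → ι z * α k) (updateAt-minimal k j (λ k → d k ℚ.* b k) k≢j) ⟩
        ι (d k ℚ.* b k) * α k       ≡⟨ cong (_* α k) (ι-* (d k) (b k)) ⟩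
        ι (d k) * ι (b k) * α k     ≡⟨ *-assoc (ι (d k)) (ι (b k)) (α k) ⟩
        ι (d k) * (ι (b k) * α k)   ≡⟨ cong (ι (d k) *_) (sym (projective-off j a b α αj≢0 k k≢j)) ⟩
        ι (d k) * (α j * y k)       ≡⟨ x∙yz≈y∙xz (ι (d k)) (α j) (y k) ⟩
        α j * (ι (d k) * y k)       ∎

      before-pivot : ι (d j ℚ.* a) ≡ before j
      before-pivot = begin
        ι (d j ℚ.* a)            ≡⟨ ι-* (d j) a ⟩
        ι (d j) * ι a            ≡⟨ cong (ι (d j) *_) (sym (projective-pivot j a b α αj≢0)) ⟩
        ι (d j) * (α j * y j)    ≡⟨ x∙yz≈y∙xz (ι (d j)) (α j) (y j) ⟩
        α j * (ι (d j) * y j)    ∎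

      after-pivot : after j ≡ α j * ι e₀
      after-pivot = trans (cong (λ z → ι z * α j) (updateAt-updates j (λ k → d k ℚ.* b k)))
                          (*-comm (ι e₀) (α j))

      cleared : ι (d j ℚ.* a) + sum after ≡ 0K
      cleared = begin
        ι (d j ℚ.* a) + sum after   ≡⟨ cong (_+ sum after) before-pivot ⟩
        before j + sum after        ≡⟨ sym (sum-exchange after before j agree) ⟩
        after j + sum before        ≡⟨ cong (_+ sum before) after-pivot ⟩
        α j * ι e₀ + sum before
          ≡⟨ cong (α j * ι e₀ +_) (sym (*-distribˡ-sum (α j) (λ k → ι (d k) * y k))) ⟩
        α j * ι e₀ + α j * sum (λ k → ι (d k) * y k)
          ≡⟨ sym (distribˡ (α j) (ι e₀) (sum (λ k → ι (d k) * y k))) ⟩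
        α j * (ι e₀ + sum (λ k → ι (d k) * y k))
          ≡⟨ cong (α j *_) (relation e₀ d rel) ⟩
        α j * 0K                    ≡⟨ zeroʳ (α j) ⟩
        0K                          ∎

      trivial : (d j ℚ.* a ≡ 0ℚ) × (∀ k → coeff k ≡ 0ℚ)
      trivial = independent li (d j ℚ.* a) coeff cleared

      e₀≡0 : e₀ ≡ 0ℚ
      e₀≡0 = trans (sym (updateAt-updates j (λ k → d k ℚ.* b k))) (proj₂ trivial j)

      d≡0 : ∀ k → d k ≡ 0ℚ
      d≡0 k with k Fin.≟ j
      ... | yes refl = *-cancelʳ-≢0 (d j) a (proj₁ trivial) a≢0
      ... | no  k≢j  = *-cancelʳ-≢0 (d k) (b k)
                         (trans (sym (updateAt-minimal k j (λ k → d k ℚ.* b k) k≢j)) (proj₂ trivial k))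
                         (b≢0 k k≢j)

  -- In the case α_j ≠ 0, F_ᾱ is the projective map with a = u_j p^n and
  -- b_i = u_i p^{k_i}, followed by the translation by −v.
  mobius-decomposition : ∀ (α : D pr 𝕂) j n (u v : Fin s → ℚ) x i →
    mobius pr 𝕂 α j n u v x i
      ≡ projective j (u j ℚ.* powℚ p pr n)
                     (λ k → u k ℚ.* powℚ p pr (kExp pr 𝕂 n (ord (α k)))) x i
        + ι (ℚ.- v i)
  mobius-decomposition α j n u v x i with i Fin.≟ j
  ... | yes refl = cong₂ _+_ (sym (updateAt-updates i _)) (sym (ι-neg (v i)))
  ... | no  i≢j  = cong₂ _+_ (sym (updateAt-minimal i j _ i≢j)) (sym (ι-neg (v i)))

  FMap-independent : ∀ {α : D pr 𝕂} {j F} → FMap pr 𝕂 α j F →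
                     LinIndep1 pr 𝕂 α → LinIndep1 pr 𝕂 (F α)
  FMap-independent (idF _) li = li
  FMap-independent {α} {j} (mobF αj≢0 n _ u v u-unit _ _ _) li =
    independent-cong (λ i → sym (mobius-decomposition α j n u v α i))
      (translate-independent _ (λ i → ℚ.- v i)
        (projective-independent α j _ _ αj≢0
          (*-≢0 (unit≢0 (u j) (u-unit j)) (powℚ≢0 pr n))
          (λ k _ → *-≢0 (unit≢0 (u k) (u-unit k)) (powℚ≢0 pr (kExp pr 𝕂 n (ord (α k)))))
          li))

lemma4 : ∀ {p d : ℕ} (pr : Prime p) (𝕂 : NumberFieldInQp p d)
           (Φ : CMap pr 𝕂) (α : D pr 𝕂) →
           LinIndep1 pr 𝕂 α → LinIndep1 pr 𝕂 (image pr 𝕂 Φ α)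
lemma4 pr 𝕂 Φ α li =
  translate-independent _ γ
    (linear-independent (F α) A Ainv A-Ainv
      (FMap-independent F-ok li))
  where
    open CMapAt (CMap.Φ Φ α)
    open Independence pr 𝕂
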